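{- Let $G=(V,E)$ be a finite undirected unsigned graph with maximum node degree $\Delta$, let $\theta^+,\theta^-:\mathbb{N}\to\mathbb{N}$ be any pair of computable threshold functions defining a local threshold-based opinion dynamics $\mathbf{d}$, and let $\omega:V\to\{0,1\}$ be any opinion configuration of $G$. Let $\langle\omega_1,\dots,\omega_T\rangle$ be the $\mathbf{d}$-evolution set of $G$ starting at $\omega$. Then \[ [110]+[100]+[011]+[001] \leq 4|E|+2|V| + 4|V|\,\Delta(\Delta+1), \] where for a binary string $y$ of length $h$, $[y]$ denotes the total number of occurrences of $y$ (as a block of consecutive entries) in the histories of all nodes.
   Context: Opinions are written as $0$ (negative) and $1$ (positive); an opinion configuration is a map $\omega:V\to\{0,1\}$. For a node $u$, $N(u)$ is its set of neighbors. Given threshold functions $\theta^+,\theta^-:\mathbb{N}\to\mathbb{N}$, the local threshold-based dynamics $\mathbf{d}$ maps a configuration $\omega$ to $\omega'=\mathbf{d}(G,\omega)$ defined by: letting $P(u)=|\{v\in N(u):\omega(v)=1\}|$, $\omega'(u)=1$ if either ($\omega(u)=1$ and $P(u)\ge\theta^+(|N(u)|)$) or ($\omega(u)=0$ and $P(u)\ge\theta^-(|N(u)|)$), and $\omega'(u)=0$ otherwise. The $\mathbf{d}$-evolution set of $G$ starting at $\omega$ is the sequence $\langle\omega_1=\omega,\omega_2,\dots,\omega_T\rangle$ of pairwise distinct configurations with $\omega_t=\mathbf{d}(G,\omega_{t-1})$ for $t=2,\dots,T$, and such that $\mathbf{d}(G,\omega_T)=\omega_h$ for some $h\le T$. The history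 of a node $v$ is the string $\omega_1(v)\omega_2(v)\cdots\omega_T(v)\in\{0,1\}^T$. For $y\in\{0,1\}^h$ and $v\in V$, $[y,v]=|\{i\in\{1,\dots,T-h+1\}: \omega_i(v)\omega_{i+1}(v)\cdots\omega_{i+h-1}(v)=y\}|$, and $[y]=\sum_{v\in V}[y,v]$. -}

module Defs where

open import Data.Nat using (ℕ; zero; suc; _+_; _*_; _∸_; _⊔_; _≤ᵇ_; _<_; _≤_)
open import Data.Bool using (Bool; true; false; if_then_else_)
open import Data.Fin using (Fin; zero; suc; toℕ)
open import Data.List using (List; upTo)
open import Data.Nat.ListAction using (sum)
import Data.List as List
open import Data.Product using (Σ; _×_)
open import Relation.Binary.PropositionalEquality using (_≡_)
open import Relation.Nullary using (¬_)
open import Function using (_∘_)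

sumF : (n : ℕ) → (Fin n → ℕ) → ℕ
sumF zero    f = 0
sumF (suc n) f = f zero + sumF n (f ∘ suc)

maxF : (n : ℕ) → (Fin n → ℕ) → ℕ
maxF zero    f = 0
maxF (suc n) f = f zero ⊔ maxF n (f ∘ suc)

countF : (n : ℕ) → (Fin n → Bool) → ℕ
countF n p = sumF n (λ i → if p i then 1 else 0)

record Graph (n : ℕ) : Set where
  field
    adj   : Fin n → Fin n → Bool
    sym   : ∀ u v → adj u v ≡ adj v u
    irrefl : ∀ u → adj u u ≡ false
open Graph public

deg : ∀ {n} → Graph n → Fin n → ℕ
deg {n} G u = countF n (adj G u)

maxDeg : ∀ {n} → Graph n → ℕ
maxDeg {n} G = maxF n (deg G)

numEdges : ∀ {n} → Graph n → ℕ
numEdges {n} G = sumF n (λ u → countF n (λ v → if suc (toℕ u) ≤ᵇ toℕ v then adj G u v else false))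

-- opinion configuration ω : V → {0,1}, with true = 1, false = 0
Config : ℕ → Set
Config n = Fin n → Bool

posNbrs : ∀ {n} → Graph n → Config n → Fin n → ℕ
posNbrs {n} G ω u = countF n (λ v → if adj G u v then ω v else false)

step : ∀ {n} → (θ⁺ θ⁻ : ℕ → ℕ) → Graph n → Config n → Config n
step θ⁺ θ⁻ G ω u =
  if ω u then θ⁺ (deg G u) ≤ᵇ posNbrs G ω u
         else θ⁻ (deg G u) ≤ᵇ posNbrs G ω u

-- ω_{t+1} = d^t(ω)   (0-indexed: config t = ω_{t+1})
config : ∀ {n} → (θ⁺ θ⁻ : ℕ → ℕ) → Graph n → Config n → ℕ → Config n
config θ⁺ θ⁻ G ω zero    = ω
config θ⁺ θ⁻ G ω (suc t) = step θ⁺ θ⁻ G (config θ⁺ θ⁻ G ω t)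

SameConfig : ∀ {n} → Config n → Config n → Set
SameConfig ω ω' = ∀ v → ω v ≡ ω' v

-- ⟨ω_1,…,ω_T⟩ is the d-evolution set of G starting at ω:
-- T ≥ 1, ω_1..ω_T pairwise distinct and d(ω_T) = ω_h for some h ≤ T
IsEvolutionLength : ∀ {n} → (θ⁺ θ⁻ : ℕ → ℕ) → Graph n → Config n → ℕ → Set
IsEvolutionLength θ⁺ θ⁻ G ω T =
  1 ≤ T
  × (∀ i j → i < T → j < T → ¬ (i ≡ j) →
       ¬ SameConfig (config θ⁺ θ⁻ G ω i) (config θ⁺ θ⁻ G ω j))
  × Σ ℕ (λ h → h < T × SameConfig (config θ⁺ θ⁻ G ω T) (config θ⁺ θ⁻ G ω h))

eqB : Bool → Bool → Bool
eqB true  true  = true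
eqB false false = true
eqB _     _     = false

-- [y,v] for y = y₀y₁y₂ : occurrences of y as a block in the history of v,
-- starting positions i ∈ {1,…,T-2} (0-indexed: i < T ∸ 2)
occ3 : ∀ {n} → (θ⁺ θ⁻ : ℕ → ℕ) → Graph n → Config n → ℕ →
       Bool → Bool → Bool → Fin n → ℕ
occ3 θ⁺ θ⁻ G ω T y₀ y₁ y₂ v =
  sum (List.map (λ i →
      if eqB (config θ⁺ θ⁻ G ω i v) y₀
      then (if eqB (config θ⁺ θ⁻ G ω (suc i) v) y₁
            then (if eqB (config θ⁺ θ⁻ G ω (suc (suc i)) v) y₂ then 1 else 0)
            else 0)
      else 0)
    (upTo (T ∸ 2)))

occ3Total : ∀ {n} → (θ⁺ θ⁻ : ℕ → ℕ) → Graph n → Config n → ℕ →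
            Bool → Bool → Bool → ℕ
occ3Total {n} θ⁺ θ⁻ G ω T y₀ y₁ y₂ = sumF n (occ3 θ⁺ θ⁻ G ω T y₀ y₁ y₂)

-- A Goles–Olivos style Lyapunov argument. For consecutive configurations x, y put
--   L(x, y) = Σ_u g_u(x u, y u) − 2 I(x, y),   I(x, y) = #{(u, v) adjacent : x u = y v = 1},
-- where g_u is built from the thresholds of u truncated to deg u + 1. Since I is
-- symmetric, one step of the dynamics x, y ↦ y, d(y) lowers L by at least the number
-- of nodes u with x u ≠ d(y) u. A block y₀y₁y₂ is one of 110, 100, 011, 001 exactly
-- when y₀ ≠ y₂, so telescoping bounds the left-hand side by L(ω₁, ω₂) − L(ω_{T-1}, ω_T),
-- which is at most the range Σ_u (4 deg u + 2) of the first part plus 2 I ≤ 4|E|.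
-- The bound holds for every T.
module Submission where

open import Defs hiding (sym)
open import Data.Bool using (Bool; true; false; if_then_else_; _∧_; _xor_)
open import Data.Bool.Properties using (∧-comm; ∧-assoc)
open import Data.Fin using (Fin; zero; suc; toℕ)
open import Data.Fin.Properties using (toℕ-injective)
open import Data.List using ([]; _∷_; upTo; applyUpTo)
import Data.List as List
open import Data.List.Properties using (map-upTo)
open import Data.Nat using (ℕ; zero; suc; _+_; _*_; _∸_; _≤_; _<_; _⊓_; _≤ᵇ_; z≤n; s≤s)
open import Data.Nat.ListAction using (sum)
open import Data.Nat.Properties
open import Data.Nat.Tactic.RingSolver using (solve)
open import Function using (_∘_)
open import Relation.Binary.PropositionalEquality
open import Relation.Nullary using (contradiction)
open import Relation.Nullary.Reflects using (ofʸ; ofⁿ)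

sumF-cong : ∀ n {f g : Fin n → ℕ} → (∀ i → f i ≡ g i) → sumF n f ≡ sumF n g
sumF-cong zero    f≡g = refl
sumF-cong (suc n) f≡g = cong₂ _+_ (f≡g zero) (sumF-cong n (f≡g ∘ suc))

sumF-mono-≤ : ∀ n {f g : Fin n → ℕ} → (∀ i → f i ≤ g i) → sumF n f ≤ sumF n g
sumF-mono-≤ zero    f≤g = z≤n
sumF-mono-≤ (suc n) f≤g = +-mono-≤ (f≤g zero) (sumF-mono-≤ n (f≤g ∘ suc))

sumF-distrib-+ : ∀ n (f g : Fin n → ℕ) → sumF n (λ i → f i + g i) ≡ sumF n f + sumF n g
sumF-distrib-+ zero    f g = refl
sumF-distrib-+ (suc n) f g = begin
  f zero + g zero + sumF n (λ i → f (suc i) + g (suc i))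
    ≡⟨ cong (f zero + g zero +_) (sumF-distrib-+ n (f ∘ suc) (g ∘ suc)) ⟩
  f zero + g zero + (sumF n (f ∘ suc) + sumF n (g ∘ suc))
    ≡⟨ +-+-swap (f zero) (g zero) _ _ ⟩
  f zero + sumF n (f ∘ suc) + (g zero + sumF n (g ∘ suc)) ∎
  where
  open ≡-Reasoning
  +-+-swap : ∀ a b c d → a + b + (c + d) ≡ a + c + (b + d)
  +-+-swap a b c d = solve (a ∷ b ∷ c ∷ d ∷ [])

*-distribˡ-sumF : ∀ n c (f : Fin n → ℕ) → c * sumF n f ≡ sumF n (λ i → c * f i)
*-distribˡ-sumF zero    c f = *-zeroʳ c
*-distribˡ-sumF (suc n) c f =
  trans (*-distribˡ-+ c (f zero) _) (cong (c * f zero +_) (*-distribˡ-sumF n c (f ∘ suc)))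

sumF-const : ∀ n c → sumF n (λ _ → c) ≡ n * c
sumF-const zero    c = refl
sumF-const (suc n) c = cong (c +_) (sumF-const n c)

sumF-comm : ∀ n m (f : Fin n → Fin m → ℕ) →
            sumF n (λ i → sumF m (f i)) ≡ sumF m (λ j → sumF n (λ i → f i j))
sumF-comm zero    m f = sym (trans (sumF-const m 0) (*-zeroʳ m))
sumF-comm (suc n) m f = trans (cong (sumF m (f zero) +_) (sumF-comm n m (f ∘ suc)))
                              (sym (sumF-distrib-+ m (f zero) _))

sum-applyUpTo : ∀ m (f : ℕ → ℕ) → sum (applyUpTo f m) ≡ sumF m (f ∘ toℕ)
sum-applyUpTo zero    f = refl
sum-applyUpTo (suc m) f = cong (f 0 +_) (sum-applyUpTo m (f ∘ suc))

sum-map-upTo : ∀ m (f : ℕ → ℕ) → sum (List.map f (upTo m)) ≡ sumF m (f ∘ toℕ)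
sum-map-upTo m f = trans (cong sum (map-upTo f m)) (sum-applyUpTo m f)

≤-maxF : ∀ n (f : Fin n → ℕ) i → f i ≤ maxF n f
≤-maxF (suc n) f zero    = m≤m⊔n _ _
≤-maxF (suc n) f (suc i) = ≤-trans (≤-maxF n (f ∘ suc) i) (m≤n⊔m _ _)

sumF-distrib-+₄ : ∀ n (f g h k : Fin n → ℕ) →
                  sumF n (λ i → f i + g i + h i + k i)
                    ≡ sumF n f + sumF n g + sumF n h + sumF n k
sumF-distrib-+₄ n f g h k =
  trans (sumF-distrib-+ n _ k)
        (cong (_+ sumF n k) (trans (sumF-distrib-+ n _ h) (cong (_+ sumF n h) (sumF-distrib-+ n f g))))

-- F − J drops by at least D i at step i; everything is moved across to avoid truncated subtraction.
telescope-≤ : ∀ (F J D : ℕ → ℕ) → (∀ i → F (suc i) + D i + J i ≤ F i + J (suc i)) →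
              ∀ m → F m + sumF m (D ∘ toℕ) + J 0 ≤ F 0 + J m
telescope-≤ F J D step zero    = ≤-reflexive (cong (_+ J 0) (+-identityʳ (F 0)))
telescope-≤ F J D step (suc m) = +-cancelˡ-≤ (F 1 + J 1) _ _ (begin
    F 1 + J 1 + (F (suc m) + (D 0 + S) + J 0)  ≡⟨ regroup (F 1) (J 1) (F (suc m)) (D 0) S (J 0) ⟩
    F (suc m) + S + J 1 + (F 1 + D 0 + J 0)    ≤⟨ +-mono-≤ shifted (step 0) ⟩
    F 1 + J (suc m) + (F 0 + J 1)              ≡⟨ exchange (F 1) (J (suc m)) (F 0) (J 1) ⟩
    F 1 + J 1 + (F 0 + J (suc m))              ∎)
  where
  open ≤-Reasoning
  S = sumF m (D ∘ suc ∘ toℕ)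
  shifted : F (suc m) + S + J 1 ≤ F 1 + J (suc m)
  shifted = telescope-≤ (F ∘ suc) (J ∘ suc) (D ∘ suc) (step ∘ suc) m
  regroup : ∀ f₁ j₁ fₘ d₀ s j₀ → f₁ + j₁ + (fₘ + (d₀ + s) + j₀) ≡ fₘ + s + j₁ + (f₁ + d₀ + j₀)
  regroup f₁ j₁ fₘ d₀ s j₀ = solve (f₁ ∷ j₁ ∷ fₘ ∷ d₀ ∷ s ∷ j₀ ∷ [])
  exchange : ∀ f₁ jₘ f₀ j₁ → f₁ + jₘ + (f₀ + j₁) ≡ f₁ + j₁ + (f₀ + jₘ)
  exchange f₁ jₘ f₀ j₁ = solve (f₁ ∷ jₘ ∷ f₀ ∷ j₁ ∷ [])

𝟙 : Bool → ℕ
𝟙 b = if b then 1 else 0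

𝟙-if-then-false-≤ : ∀ a b → 𝟙 (if a then b else false) ≤ 𝟙 a
𝟙-if-then-false-≤ true  b = 𝟙≤1 b
  where
  𝟙≤1 : ∀ b → 𝟙 b ≤ 1
  𝟙≤1 true  = ≤-refl
  𝟙≤1 false = z≤n
𝟙-if-then-false-≤ false b = z≤n

if-then-false≡∧ : ∀ a b → (if a then b else false) ≡ a ∧ b
if-then-false≡∧ true  b = refl
if-then-false≡∧ false b = refl

∧-reverse : ∀ p q r → p ∧ (q ∧ r) ≡ r ∧ (q ∧ p)
∧-reverse p q r = begin
  p ∧ (q ∧ r)  ≡⟨ ∧-comm p (q ∧ r) ⟩
  (q ∧ r) ∧ p  ≡⟨ cong (_∧ p) (∧-comm q r) ⟩
  (r ∧ q) ∧ p  ≡⟨ ∧-assoc r q p ⟩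
  r ∧ (q ∧ p)  ∎
  where open ≡-Reasoning

module _ {n : ℕ} (G : Graph n) where

  posNbrs≤deg : ∀ y u → posNbrs G y u ≤ deg G u
  posNbrs≤deg y u = sumF-mono-≤ n (λ v → 𝟙-if-then-false-≤ (adj G u v) (y v))

  adj-split : ∀ u v → 𝟙 (adj G u v) ≡ 𝟙 (if suc (toℕ u) ≤ᵇ toℕ v then adj G u v else false)
                                      + 𝟙 (if suc (toℕ v) ≤ᵇ toℕ u then adj G v u else false)
  adj-split u v with suc (toℕ u) ≤ᵇ toℕ v | ≤ᵇ-reflects-≤ (suc (toℕ u)) (toℕ v)
                   | suc (toℕ v) ≤ᵇ toℕ u | ≤ᵇ-reflects-≤ (suc (toℕ v)) (toℕ u)
  ... | true  | ofʸ u<v | true  | ofʸ v<u = contradiction u<v (<-asym v<u)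
  ... | true  | ofʸ _   | false | ofⁿ _   = sym (+-identityʳ _)
  ... | false | ofⁿ _   | true  | ofʸ _   = cong 𝟙 (Graph.sym G u v)
  ... | false | ofⁿ u≮v | false | ofⁿ v≮u
    rewrite toℕ-injective {i = v} {j = u} (≤-antisym (≮⇒≥ u≮v) (≮⇒≥ v≮u)) =
      cong 𝟙 (Graph.irrefl G u)

  sum-deg≡2*numEdges : sumF n (deg G) ≡ 2 * numEdges G
  sum-deg≡2*numEdges = begin
    sumF n (λ u → sumF n (λ v → 𝟙 (adj G u v)))
      ≡⟨ sumF-cong n (λ u → sumF-cong n (adj-split u)) ⟩
    sumF n (λ u → sumF n (λ v → 𝟙 (above u v) + 𝟙 (above v u)))
      ≡⟨ sumF-cong n (λ u → sumF-distrib-+ n _ _) ⟩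
    sumF n (λ u → sumF n (λ v → 𝟙 (above u v)) + sumF n (λ v → 𝟙 (above v u)))
      ≡⟨ sumF-distrib-+ n _ _ ⟩
    numEdges G + sumF n (λ u → sumF n (λ v → 𝟙 (above v u)))
      ≡⟨ cong (numEdges G +_) (sumF-comm n n (λ u v → 𝟙 (above v u))) ⟩
    numEdges G + numEdges G
      ≡⟨ cong (numEdges G +_) (sym (+-identityʳ _)) ⟩
    2 * numEdges G ∎
    where
    open ≡-Reasoning
    above : Fin n → Fin n → Bool
    above u v = if suc (toℕ u) ≤ᵇ toℕ v then adj G u v else false

  links : Config n → Config n → Fin n → ℕ
  links x y u = if x u then posNbrs G y u else 0

  interaction : Config n → Config n → ℕ
  interaction x y = sumF n (links x y)

  interaction≡double-sum : ∀ x y →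
    interaction x y ≡ sumF n (λ u → countF n (λ v → x u ∧ (adj G u v ∧ y v)))
  interaction≡double-sum x y = sumF-cong n links≡
    where
    links≡ : ∀ u → links x y u ≡ countF n (λ v → x u ∧ (adj G u v ∧ y v))
    links≡ u with x u
    ... | true  = sumF-cong n (λ v → cong 𝟙 (if-then-false≡∧ (adj G u v) (y v)))
    ... | false = sym (trans (sumF-const n 0) (*-zeroʳ n))

  interaction-sym : ∀ x y → interaction x y ≡ interaction y x
  interaction-sym x y = begin
    interaction x y
      ≡⟨ interaction≡double-sum x y ⟩
    sumF n (λ u → sumF n (λ v → 𝟙 (x u ∧ (adj G u v ∧ y v))))
      ≡⟨ sumF-comm n n _ ⟩
    sumF n (λ v → sumF n (λ u → 𝟙 (x u ∧ (adj G u v ∧ y v))))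
      ≡⟨ sumF-cong n (λ v → sumF-cong n (λ u → cong 𝟙 (reverse u v))) ⟩
    sumF n (λ v → sumF n (λ u → 𝟙 (y v ∧ (adj G v u ∧ x u))))
      ≡⟨ sym (interaction≡double-sum y x) ⟩
    interaction y x ∎
    where
    open ≡-Reasoning
    reverse : ∀ u v → x u ∧ (adj G u v ∧ y v) ≡ y v ∧ (adj G v u ∧ x u)
    reverse u v = trans (∧-reverse (x u) (adj G u v) (y v)) (cong (λ a → y v ∧ (a ∧ x u)) (Graph.sym G u v))

  interaction≤2*numEdges : ∀ x y → interaction x y ≤ 2 * numEdges G
  interaction≤2*numEdges x y =
    ≤-trans (sumF-mono-≤ n links≤deg) (≤-reflexive sum-deg≡2*numEdges)
    where
    links≤deg : ∀ u → links x y u ≤ deg G u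
    links≤deg u with x u
    ... | true  = posNbrs≤deg y u
    ... | false = z≤n

data Response (a b P : ℕ) : Bool → Bool → Set where
  stays-0 : P < b → Response a b P false false
  turns-1 : b ≤ P → Response a b P false true
  turns-0 : P < a → Response a b P true false
  stays-1 : a ≤ P → Response a b P true true

-- Truncating thresholds to d + 1 keeps the potential bounded and, as P ≤ d, does not
-- change the response.
step-response : ∀ θ⁺ θ⁻ {d P} y → P ≤ d →
  Response (θ⁺ ⊓ suc d) (θ⁻ ⊓ suc d) P y (if y then θ⁺ ≤ᵇ P else θ⁻ ≤ᵇ P)
step-response θ⁺ θ⁻ {P = P} false P≤d with θ⁻ ≤ᵇ P | ≤ᵇ-reflects-≤ θ⁻ P
... | true  | ofʸ θ≤P = turns-1 (≤-trans (m⊓n≤m θ⁻ _) θ≤P)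
... | false | ofⁿ θ≰P = stays-0 (⊓-glb (≰⇒> θ≰P) (s≤s P≤d))
step-response θ⁺ θ⁻ {P = P} true  P≤d with θ⁺ ≤ᵇ P | ≤ᵇ-reflects-≤ θ⁺ P
... | true  | ofʸ θ≤P = stays-1 (≤-trans (m⊓n≤m θ⁺ _) θ≤P)
... | false | ofⁿ θ≰P = turns-0 (⊓-glb (≰⇒> θ≰P) (s≤s P≤d))

-- Indexed by the number of 1s among a node's opinions at two consecutive times. Up to
-- an additive constant these values are forced by nodePotential-step at the extreme P.
nodePotential : (a b : ℕ) → ℕ → ℕ
nodePotential a b 0             = 2
nodePotential a b 1             = 1 + 2 * b
nodePotential a b (suc (suc _)) = 2 * a + 2 * b

+-double-monoʳ-≤ : ∀ c {m n} → m ≤ n → c + 2 * m ≤ c + 2 * n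
+-double-monoʳ-≤ c m≤n = +-monoʳ-≤ c (*-monoʳ-≤ 2 m≤n)

nodePotential-step : ∀ {a b P y z} → Response a b P y z → ∀ x →
  nodePotential a b (𝟙 y + 𝟙 z) + 𝟙 (x xor z) + 2 * (if x then P else 0)
    ≤ nodePotential a b (𝟙 x + 𝟙 y) + 2 * (if z then P else 0)
nodePotential-step             (stays-0 P<b) false = ≤-refl
nodePotential-step {b = b} {P} (stays-0 P<b) true  = begin
  3 + 2 * P         ≡⟨ solve (P ∷ []) ⟩
  1 + 2 * suc P     ≤⟨ +-double-monoʳ-≤ 1 P<b ⟩
  1 + 2 * b         ≡⟨ sym (+-identityʳ _) ⟩
  1 + 2 * b + 0     ∎
  where open ≤-Reasoning
nodePotential-step {b = b} {P} (turns-1 b≤P) false = begin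
  1 + 2 * b + 1 + 0 ≡⟨ solve (b ∷ []) ⟩
  2 + 2 * b         ≤⟨ +-double-monoʳ-≤ 2 b≤P ⟩
  2 + 2 * P         ∎
  where open ≤-Reasoning
nodePotential-step {b = b} {P} (turns-1 b≤P) true  =
  ≤-reflexive (cong (_+ 2 * P) (+-identityʳ (1 + 2 * b)))
nodePotential-step             (turns-0 P<a) false = ≤-reflexive (+-identityʳ _)
nodePotential-step {a} {b} {P} (turns-0 P<a) true  = begin
  1 + 2 * b + 1 + 2 * P ≡⟨ solve (b ∷ P ∷ []) ⟩
  2 * b + 2 * suc P     ≤⟨ +-double-monoʳ-≤ (2 * b) P<a ⟩
  2 * b + 2 * a         ≡⟨ solve (a ∷ b ∷ []) ⟩
  2 * a + 2 * b + 0     ∎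
  where open ≤-Reasoning
nodePotential-step {a} {b} {P} (stays-1 a≤P) false = begin
  2 * a + 2 * b + 1 + 0 ≡⟨ solve (a ∷ b ∷ []) ⟩
  1 + 2 * b + 2 * a     ≤⟨ +-double-monoʳ-≤ (1 + 2 * b) a≤P ⟩
  1 + 2 * b + 2 * P     ∎
  where open ≤-Reasoning
nodePotential-step {a} {b} {P} (stays-1 a≤P) true  =
  ≤-reflexive (cong (_+ 2 * P) (+-identityʳ (2 * a + 2 * b)))

nodePotential-range : ∀ {a b d} → a ≤ suc d → b ≤ suc d → ∀ k l →
  nodePotential a b k ≤ nodePotential a b l + (4 * d + 2)
nodePotential-range {a} {b} {d} a≤ b≤ = range
  where
  open ≤-Reasoning
  range : ∀ k l → nodePotential a b k ≤ nodePotential a b l + (4 * d + 2)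
  range 0 l = ≤-trans (m≤n+m 2 (4 * d)) (m≤n+m _ (nodePotential a b l))
  range 1 0 = begin
    1 + 2 * b                        ≤⟨ +-double-monoʳ-≤ 1 b≤ ⟩
    1 + 2 * suc d                    ≤⟨ m≤m+n _ (2 * d + 1) ⟩
    1 + 2 * suc d + (2 * d + 1)      ≡⟨ solve (d ∷ []) ⟩
    2 + (4 * d + 2)                  ∎
  range 1 1 = m≤m+n _ _
  range 1 (suc (suc _)) = begin
    1 + 2 * b                        ≤⟨ m≤m+n _ (2 * a + 4 * d + 1) ⟩
    1 + 2 * b + (2 * a + 4 * d + 1)  ≡⟨ solve (a ∷ b ∷ d ∷ []) ⟩
    2 * a + 2 * b + (4 * d + 2)      ∎
  range (suc (suc _)) 0 = begin
    2 * a + 2 * b                    ≤⟨ +-mono-≤ (*-monoʳ-≤ 2 a≤) (*-monoʳ-≤ 2 b≤) ⟩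
    2 * suc d + 2 * suc d            ≡⟨ solve (d ∷ []) ⟩
    2 + (4 * d + 2)                  ∎
  range (suc (suc _)) 1 = begin
    2 * a + 2 * b                    ≤⟨ +-monoˡ-≤ (2 * b) (*-monoʳ-≤ 2 a≤) ⟩
    2 * suc d + 2 * b                ≤⟨ m≤m+n _ (2 * d + 1) ⟩
    2 * suc d + 2 * b + (2 * d + 1)  ≡⟨ solve (b ∷ d ∷ []) ⟩
    1 + 2 * b + (4 * d + 2)          ∎
  range (suc (suc _)) (suc (suc _)) = m≤m+n _ _

matches₃ : Bool → Bool → Bool → Bool → Bool → Bool → ℕ
matches₃ p q r y₀ y₁ y₂ =
  if eqB p y₀ then (if eqB q y₁ then (if eqB r y₂ then 1 else 0) else 0) else 0

matches₃-oscillating : ∀ p q r →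
  matches₃ p q r true true false + matches₃ p q r true false false
    + matches₃ p q r false true true + matches₃ p q r false false true
  ≡ 𝟙 (p xor r)
matches₃-oscillating true  true  true  = refl
matches₃-oscillating true  true  false = refl
matches₃-oscillating true  false true  = refl
matches₃-oscillating true  false false = refl
matches₃-oscillating false true  true  = refl
matches₃-oscillating false true  false = refl
matches₃-oscillating false false true  = refl
matches₃-oscillating false false false = refl

module Dynamics {n : ℕ} (G : Graph n) (θ⁺ θ⁻ : ℕ → ℕ) where

  truncate : (ℕ → ℕ) → Fin n → ℕ
  truncate θ u = θ (deg G u) ⊓ suc (deg G u)

  nodeTerm : Config n → Config n → Fin n → ℕ
  nodeTerm x y u = nodePotential (truncate θ⁺ u) (truncate θ⁻ u) (𝟙 (x u) + 𝟙 (y u))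

  potential : Config n → Config n → ℕ
  potential x y = sumF n (nodeTerm x y)

  changes : Config n → Config n → ℕ
  changes x z = countF n (λ u → x u xor z u)

  potential-step : ∀ x y → let z = step θ⁺ θ⁻ G y in
    potential y z + changes x z + 2 * interaction G x y ≤ potential x y + 2 * interaction G y z
  potential-step x y = begin
    potential y z + changes x z + 2 * interaction G x y
      ≡⟨ cong (potential y z + changes x z +_) (*-distribˡ-sumF n 2 _) ⟩
    potential y z + changes x z + sumF n (λ u → 2 * links G x y u)
      ≡⟨ sym (trans (sumF-distrib-+ n _ _) (cong (_+ _) (sumF-distrib-+ n _ _))) ⟩
    sumF n (λ u → nodeTerm y z u + 𝟙 (x u xor z u) + 2 * links G x y u)
      ≤⟨ sumF-mono-≤ n (λ u → nodePotential-step (response u) (x u)) ⟩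
    sumF n (λ u → nodeTerm x y u + 2 * links G z y u)
      ≡⟨ sumF-distrib-+ n _ _ ⟩
    potential x y + sumF n (λ u → 2 * links G z y u)
      ≡⟨ cong (potential x y +_) (sym (*-distribˡ-sumF n 2 _)) ⟩
    potential x y + 2 * interaction G z y
      ≡⟨ cong (λ i → potential x y + 2 * i) (interaction-sym G z y) ⟩
    potential x y + 2 * interaction G y z ∎
    where
    open ≤-Reasoning
    z = step θ⁺ θ⁻ G y
    response : ∀ u → Response (truncate θ⁺ u) (truncate θ⁻ u) (posNbrs G y u) (y u) (z u)
    response u = step-response (θ⁺ (deg G u)) (θ⁻ (deg G u)) (y u) (posNbrs≤deg G y u)

  budget : ℕ
  budget = sumF n (λ u → 4 * deg G u + 2)

  potential-range : ∀ x y x' y' → potential x y ≤ potential x' y' + budget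
  potential-range x y x' y' =
    ≤-trans (sumF-mono-≤ n (λ u → nodePotential-range (m⊓n≤n _ _) (m⊓n≤n _ _)
                                    (𝟙 (x u) + 𝟙 (y u)) (𝟙 (x' u) + 𝟙 (y' u))))
            (≤-reflexive (sumF-distrib-+ n _ _))

  budget≤maxDeg-bound : budget ≤ n * (2 + 4 * (maxDeg G * (maxDeg G + 1)))
  budget≤maxDeg-bound = ≤-trans (sumF-mono-≤ n node≤) (≤-reflexive (sumF-const n _))
    where
    Δ = maxDeg G
    node≤ : ∀ u → 4 * deg G u + 2 ≤ 2 + 4 * (Δ * (Δ + 1))
    node≤ u = begin
      4 * deg G u + 2       ≡⟨ +-comm _ 2 ⟩
      2 + 4 * deg G u       ≤⟨ +-monoʳ-≤ 2 (*-monoʳ-≤ 4 (≤-maxF n (deg G) u)) ⟩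
      2 + 4 * Δ             ≡⟨ cong (λ k → 2 + 4 * k) (sym (*-identityʳ Δ)) ⟩
      2 + 4 * (Δ * 1)       ≤⟨ +-monoʳ-≤ 2 (*-monoʳ-≤ 4 (*-monoʳ-≤ Δ (m≤n+m 1 Δ))) ⟩
      2 + 4 * (Δ * (Δ + 1)) ∎
      where open ≤-Reasoning

  module Trajectory (ω : Config n) where

    ω[_] : ℕ → Config n
    ω[_] = config θ⁺ θ⁻ G ω

    oscillations : ℕ → ℕ
    oscillations T = occ3Total θ⁺ θ⁻ G ω T true true false
                   + occ3Total θ⁺ θ⁻ G ω T true false false
                   + occ3Total θ⁺ θ⁻ G ω T false true true
                   + occ3Total θ⁺ θ⁻ G ω T false false true

    changeAt : ℕ → ℕ
    changeAt i = changes ω[ i ] ω[ suc (suc i) ]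

    oscillations≡changes : ∀ T → oscillations T ≡ sumF (T ∸ 2) (changeAt ∘ toℕ)
    oscillations≡changes T = begin
      oscillations T
        ≡⟨ sym (sumF-distrib-+₄ n (occ true true false) (occ true false false)
                                  (occ false true true) (occ false false true)) ⟩
      sumF n (λ v → occ true true false v + occ true false false v
                    + occ false true true v + occ false false true v)
        ≡⟨ sumF-cong n node ⟩
      sumF n (λ v → sumF m (λ i → flipped v (toℕ i)))
        ≡⟨ sumF-comm n m _ ⟩
      sumF m (changeAt ∘ toℕ) ∎
      where
      open ≡-Reasoning
      m = T ∸ 2
      occ : Bool → Bool → Bool → Fin n → ℕ
      occ = occ3 θ⁺ θ⁻ G ω T
      flipped : Fin n → ℕ → ℕ
      flipped v i = 𝟙 (ω[ i ] v xor ω[ suc (suc i) ] v)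
      node : ∀ v → occ true true false v + occ true false false v
                   + occ false true true v + occ false false true v
                 ≡ sumF m (λ i → flipped v (toℕ i))
      node v =
        trans (cong₂ _+_ (cong₂ _+_ (cong₂ _+_ (sum-map-upTo m _) (sum-map-upTo m _)) (sum-map-upTo m _))
                         (sum-map-upTo m _))
        (trans (sym (sumF-distrib-+₄ m _ _ _ _))
               (sumF-cong m (λ i → matches₃-oscillating (ω[ toℕ i ] v) (ω[ suc (toℕ i) ] v)
                                                          (ω[ suc (suc (toℕ i)) ] v))))

    potentialAt twiceInteractionAt : ℕ → ℕ
    potentialAt   i = potential ω[ i ] ω[ suc i ]
    twiceInteractionAt i = 2 * interaction G ω[ i ] ω[ suc i ]

    total-changes≤ : ∀ m → sumF m (changeAt ∘ toℕ) ≤ budget + 2 * (2 * numEdges G)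
    total-changes≤ m = +-cancelˡ-≤ (potentialAt m) _ _ (begin
      potentialAt m + S
        ≤⟨ m≤m+n _ (twiceInteractionAt 0) ⟩
      potentialAt m + S + twiceInteractionAt 0
        ≤⟨ telescope-≤ potentialAt twiceInteractionAt changeAt (λ i → potential-step ω[ i ] ω[ suc i ]) m ⟩
      potentialAt 0 + twiceInteractionAt m
        ≤⟨ +-mono-≤ (potential-range ω[ 0 ] ω[ 1 ] ω[ m ] ω[ suc m ])
                    (*-monoʳ-≤ 2 (interaction≤2*numEdges G ω[ m ] ω[ suc m ])) ⟩
      potentialAt m + budget + 2 * (2 * numEdges G)
        ≡⟨ +-assoc (potentialAt m) _ _ ⟩
      potentialAt m + (budget + 2 * (2 * numEdges G)) ∎)
      where
      open ≤-Reasoning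
      S = sumF m (changeAt ∘ toℕ)

lemma1 : (n : ℕ) (G : Graph n) (θ⁺ θ⁻ : ℕ → ℕ) (ω : Config n) (T : ℕ) →
         IsEvolutionLength θ⁺ θ⁻ G ω T →
         occ3Total θ⁺ θ⁻ G ω T true true false
           + occ3Total θ⁺ θ⁻ G ω T true false false
           + occ3Total θ⁺ θ⁻ G ω T false true true
           + occ3Total θ⁺ θ⁻ G ω T false false true
         ≤ 4 * numEdges G + 2 * n + 4 * n * (maxDeg G * (maxDeg G + 1))
lemma1 n G θ⁺ θ⁻ ω T _ = begin
  oscillations T                                 ≡⟨ oscillations≡changes T ⟩
  sumF (T ∸ 2) (changeAt ∘ toℕ)                  ≤⟨ total-changes≤ (T ∸ 2) ⟩
  budget + 2 * (2 * numEdges G)                  ≤⟨ +-monoˡ-≤ _ budget≤maxDeg-bound ⟩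
  n * (2 + 4 * X) + 2 * (2 * numEdges G)         ≡⟨ regroup n (numEdges G) X ⟩
  4 * numEdges G + 2 * n + 4 * n * X             ∎
  where
  open Dynamics G θ⁺ θ⁻
  open Trajectory ω
  open ≤-Reasoning
  X = maxDeg G * (maxDeg G + 1)
  regroup : ∀ n e x → n * (2 + 4 * x) + 2 * (2 * e) ≡ 4 * e + 2 * n + 4 * n * x
  regroup n e x = solve (n ∷ e ∷ x ∷ [])
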